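{- Let $n\geq0$ and $k\geq2$. For every formula $\alpha$: if $\vdash_{L_n^k}\alpha$, then $\vDash_{\mathcal{R}_n^k}\alpha$.
   Context: Formulas are built from propositional variables using unary $\neg,\circ$ and binary $\land,\lor,\to$; $\circ^0\alpha=\alpha$, $\circ^{m+1}\alpha=\circ\circ^m\alpha$, $\alpha\leftrightarrow\beta:=(\alpha\to\beta)\land(\beta\to\alpha)$. Logics are Hilbert calculi with modus ponens as only rule and axiom schemas. mbC has the positive classical axioms $\alpha\to(\beta\to\alpha)$; $(\alpha\to\beta)\to((\alpha\to(\beta\to\gamma))\to(\alpha\to\gamma))$; $\alpha\to(\beta\to(\alpha\land\beta))$; $(\alpha\land\beta)\to\alpha$; $(\alpha\land\beta)\to\beta$; $\alpha\to(\alpha\lor\beta)$; $\beta\to(\alpha\lor\beta)$; $(\alpha\to\gamma)\to((\beta\to\gamma)\to((\alpha\lor\beta)\to\gamma))$; $\alpha\lor(\alpha\to\beta)$; plus $\alpha\lor\neg\alpha$ and $\circ\alpha\to(\alpha\to(\neg\alpha\to\beta))$. mbCciw = mbC + $\circ\alpha\lor(\alpha\land\neg\alpha)$. $L_n^0$ = mbCciw + (cc$^n$) $\circ^{n+2}\alpha$; $L_n^1$ = $L_n^0$ + (dn) $\neg\neg\alpha\leftrightarrow\alpha$; $L_n^k$ = $L_n^1$ + (ip$^j$) $\neg\circ^j\neg\alpha\leftrightarrow\neg\circ^j\alpha$ for all $1\leq j<k$. $\mathcal{M}_1$ is the Nmatrix (of the logic Cbr) with domain $\{T,t,F\}$, designated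 set $D=\{T,t\}$: for $\#\in\{\land,\lor,\to\}$, $x\#y=\{T,t\}$ if the classical truth function $\#$ applied to the designation status of $x,y$ gives true and $\{F\}$ otherwise; $\neg T=\{F\}$, $\neg t=\{t\}$, $\neg F=\{T\}$; $\circ T=\circ F=\{T,t\}$, $\circ t=\{F\}$. A valuation over $\mathcal{M}_1$ is a map $\vartheta$ from formulas into $\{T,t,F\}$ with $\vartheta(\neg\beta)\in\neg\vartheta(\beta)$, $\vartheta(\circ\beta)\in\circ\vartheta(\beta)$, $\vartheta(\beta\#\gamma)\in\vartheta(\beta)\#\vartheta(\gamma)$. $\mathcal{F}_n^k$ is the set of such valuations satisfying, for all formulas $\beta$: (vCc$^n$) if $\vartheta(\circ^n\beta)\in\{T,F\}$ then $\vartheta(\circ^{n+1}\beta)=T$; and (vip$^j$) $\vartheta(\circ^j\beta)=\vartheta(\circ^j\neg\beta)$ for every $1\leq j\leq k-1$. $\vDash_{\mathcal{R}_n^k}\alpha$ means $\vartheta(\alpha)\in D$ for every $\vartheta\in\mathcal{F}_n^k$. -}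

module Defs where

open import Data.Nat using (ℕ; zero; suc; _≤_; _<_)
open import Data.Bool using (Bool; true; false; _∧_; _∨_; not)
open import Relation.Binary.PropositionalEquality using (_≡_)
open import Data.Sum using (_⊎_)

infixr 5 _⇒_
infixr 6 _∨'_
infixr 7 _∧'_
data Form : Set where
  var  : ℕ → Form
  ¬'_  : Form → Form
  ∘'_  : Form → Form
  _∧'_ : Form → Form → Form
  _∨'_ : Form → Form → Form
  _⇒_  : Form → Form → Form

∘^ : ℕ → Form → Form
∘^ zero    α = α
∘^ (suc m) α = ∘' (∘^ m α)

_⇔'_ : Form → Form → Form
α ⇔' β = (α ⇒ β) ∧' (β ⇒ α)

-- Axiom schemas of L_n^k (parameters n k).
-- mbC, ciw, cc^n; (dn) when k ≥ 1; (ip^j) for 1 ≤ j < k.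
data Axiom (n k : ℕ) : Form → Set where
  ax1   : ∀ α β → Axiom n k (α ⇒ (β ⇒ α))
  ax2   : ∀ α β γ → Axiom n k ((α ⇒ β) ⇒ ((α ⇒ (β ⇒ γ)) ⇒ (α ⇒ γ)))
  ax3   : ∀ α β → Axiom n k (α ⇒ (β ⇒ (α ∧' β)))
  ax4   : ∀ α β → Axiom n k ((α ∧' β) ⇒ α)
  ax5   : ∀ α β → Axiom n k ((α ∧' β) ⇒ β)
  ax6   : ∀ α β → Axiom n k (α ⇒ (α ∨' β))
  ax7   : ∀ α β → Axiom n k (β ⇒ (α ∨' β))
  ax8   : ∀ α β γ → Axiom n k ((α ⇒ γ) ⇒ ((β ⇒ γ) ⇒ ((α ∨' β) ⇒ γ)))
  ax9   : ∀ α β → Axiom n k (α ∨' (α ⇒ β))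
  ax10  : ∀ α → Axiom n k (α ∨' (¬' α))
  bc1   : ∀ α β → Axiom n k ((∘' α) ⇒ (α ⇒ ((¬' α) ⇒ β)))
  ciw   : ∀ α → Axiom n k ((∘' α) ∨' (α ∧' (¬' α)))
  cc    : ∀ α → Axiom n k (∘^ (suc (suc n)) α)
  dn    : ∀ α → 1 ≤ k → Axiom n k ((¬' (¬' α)) ⇔' α)
  ip    : ∀ j α → 1 ≤ j → j < k →
          Axiom n k ((¬' (∘^ j (¬' α))) ⇔' (¬' (∘^ j α)))

data ⊢[_,_]_ (n k : ℕ) : Form → Set where
  axiom : ∀ {α} → Axiom n k α → ⊢[ n , k ] α
  mp    : ∀ {α β} → ⊢[ n , k ] α → ⊢[ n , k ] (α ⇒ β) → ⊢[ n , k ] β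

data V : Set where
  T t F : V

des : V → Bool
des T = true
des t = true
des F = false

-- ¬T = {F}, ¬t = {t}, ¬F = {T} (all singletons)
negV : V → V
negV T = F
negV t = t
negV F = T

-- ∘T = ∘F = {T,t} (designated), ∘t = {F} (undesignated)
circD : V → Bool
circD T = true
circD t = false
circD F = true

_→B_ : Bool → Bool → Bool
a →B b = not a ∨ b

-- Valuations over M_1. For x#y: value in {T,t} iff classical # of the
-- designation statuses is true, else F; i.e. des of the value equals it.
record Valuation : Set where
  field
    val   : Form → V
    v-neg : ∀ β → val (¬' β) ≡ negV (val β)
    v-circ : ∀ β → des (val (∘' β)) ≡ circD (val β)
    v-and : ∀ β γ → des (val (β ∧' γ)) ≡ (des (val β) ∧ des (val γ))
    v-or  : ∀ β γ → des (val (β ∨' γ)) ≡ (des (val β) ∨ des (val γ))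
    v-imp : ∀ β γ → des (val (β ⇒ γ)) ≡ (des (val β) →B des (val γ))
open Valuation public

record InF (n k : ℕ) (ϑ : Valuation) : Set where
  field
    vCc  : ∀ β → (val ϑ (∘^ n β) ≡ T ⊎ val ϑ (∘^ n β) ≡ F) →
           val ϑ (∘^ (suc n) β) ≡ T
    vip  : ∀ j β → 1 ≤ j → j < k → val ϑ (∘^ j β) ≡ val ϑ (∘^ j (¬' β))

⊨R[_,_]_ : ℕ → ℕ → Form → Set
⊨R[ n , k ] α = ∀ (ϑ : Valuation) → InF n k ϑ → des (val ϑ α) ≡ true

{-# OPTIONS --safe #-}
module Submission where

-- Designation behaves classically for
-- ∧, ∨, ⇒, so modus ponens preserves it and the positive axioms are designated
-- as tautologies. By (vCc^n) the value of ∘^(n+1) α is classical (T or F), so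
-- ∘^(n+2) α is designated; for (dn) and (ip^j) both sides of the biconditional
-- get the same value, since ¬ is deterministic and involutive and (vip^j) holds.

open import Defs
open import Data.Nat using (ℕ; suc; _≤_; _<_)
open import Data.Bool using (true; false; _∧_; _∨_)
open import Data.Empty using (⊥; ⊥-elim)
open import Data.Product using (_×_; _,_)
open import Data.Sum using (_⊎_; inj₁; inj₂; [_,_]′; map₂)
open import Relation.Binary.PropositionalEquality using (_≡_; refl; sym; trans; cong; module ≡-Reasoning)

→B-intro : ∀ {a b} → (a ≡ true → b ≡ true) → (a →B b) ≡ true
→B-intro {false} _ = refl
→B-intro {true}  f = f refl

→B-elim : ∀ {a b} → (a →B b) ≡ true → a ≡ true → b ≡ true
→B-elim h refl = h

true-or-→B : ∀ a {b} → a ≡ true ⊎ (a →B b) ≡ true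
true-or-→B true  = inj₁ refl
true-or-→B false = inj₂ refl

∧-intro : ∀ {a b} → a ≡ true → b ≡ true → (a ∧ b) ≡ true
∧-intro refl refl = refl

∧-elimˡ : ∀ {a b} → (a ∧ b) ≡ true → a ≡ true
∧-elimˡ {true} _ = refl

∧-elimʳ : ∀ {a b} → (a ∧ b) ≡ true → b ≡ true
∧-elimʳ {true} h = h

∨-introˡ : ∀ {a b} → a ≡ true → (a ∨ b) ≡ true
∨-introˡ refl = refl

∨-introʳ : ∀ {a b} → b ≡ true → (a ∨ b) ≡ true
∨-introʳ {true}  _ = refl
∨-introʳ {false} h = h

∨-elim : ∀ {a b} → (a ∨ b) ≡ true → a ≡ true ⊎ b ≡ true
∨-elim {true}  _ = inj₁ refl
∨-elim {false} h = inj₂ h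

Classical : V → Set
Classical x = x ≡ T ⊎ x ≡ F

negV-involutive : ∀ x → negV (negV x) ≡ x
negV-involutive T = refl
negV-involutive t = refl
negV-involutive F = refl

des-or-des-negV : ∀ x → des x ≡ true ⊎ des (negV x) ≡ true
des-or-des-negV T = inj₁ refl
des-or-des-negV t = inj₁ refl
des-or-des-negV F = inj₂ refl

circD-or-contradictory : ∀ x → circD x ≡ true ⊎ (des x ≡ true × des (negV x) ≡ true)
circD-or-contradictory T = inj₁ refl
circD-or-contradictory t = inj₂ (refl , refl)
circD-or-contradictory F = inj₁ refl

circD-explosive : ∀ x → circD x ≡ true → des x ≡ true → des (negV x) ≡ true → ⊥
circD-explosive T _ _ ()
circD-explosive t ()
circD-explosive F _ ()

circD-classical : ∀ {x} → Classical x → circD x ≡ true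
circD-classical (inj₁ refl) = refl
circD-classical (inj₂ refl) = refl

-- y is a value of ∘x obeying (vCc); for x = t it is undesignated, hence F.
classical-circ : ∀ x y → des y ≡ circD x → (Classical x → y ≡ T) → Classical y
classical-circ T _ _ vCc = inj₁ (vCc (inj₁ refl))
classical-circ F _ _ vCc = inj₁ (vCc (inj₂ refl))
classical-circ t F _ _   = inj₂ refl
classical-circ t T () _
classical-circ t t () _

_⊨_ : Valuation → Form → Set
ϑ ⊨ α = des (val ϑ α) ≡ true

module _ (ϑ : Valuation) where

  ⊨-⇒-intro : ∀ {α β} → (ϑ ⊨ α → ϑ ⊨ β) → ϑ ⊨ (α ⇒ β)
  ⊨-⇒-intro {α} {β} f = trans (v-imp ϑ α β) (→B-intro f)

  ⊨-⇒-elim : ∀ {α β} → ϑ ⊨ (α ⇒ β) → ϑ ⊨ α → ϑ ⊨ β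
  ⊨-⇒-elim {α} {β} h = →B-elim (trans (sym (v-imp ϑ α β)) h)

  ⊨-∧-intro : ∀ {α β} → ϑ ⊨ α → ϑ ⊨ β → ϑ ⊨ (α ∧' β)
  ⊨-∧-intro {α} {β} a b = trans (v-and ϑ α β) (∧-intro a b)

  ⊨-∧-elimˡ : ∀ {α β} → ϑ ⊨ (α ∧' β) → ϑ ⊨ α
  ⊨-∧-elimˡ {α} {β} h = ∧-elimˡ (trans (sym (v-and ϑ α β)) h)

  ⊨-∧-elimʳ : ∀ {α β} → ϑ ⊨ (α ∧' β) → ϑ ⊨ β
  ⊨-∧-elimʳ {α} {β} h = ∧-elimʳ {des (val ϑ α)} (trans (sym (v-and ϑ α β)) h)

  ⊨-∨-introˡ : ∀ {α β} → ϑ ⊨ α → ϑ ⊨ (α ∨' β)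
  ⊨-∨-introˡ {α} {β} a = trans (v-or ϑ α β) (∨-introˡ a)

  ⊨-∨-introʳ : ∀ {α β} → ϑ ⊨ β → ϑ ⊨ (α ∨' β)
  ⊨-∨-introʳ {α} {β} b = trans (v-or ϑ α β) (∨-introʳ {des (val ϑ α)} b)

  ⊨-∨-elim : ∀ {α β} → ϑ ⊨ (α ∨' β) → ϑ ⊨ α ⊎ ϑ ⊨ β
  ⊨-∨-elim {α} {β} h = ∨-elim (trans (sym (v-or ϑ α β)) h)

  ⊨-or-⊨-⇒ : ∀ α β → ϑ ⊨ α ⊎ ϑ ⊨ (α ⇒ β)
  ⊨-or-⊨-⇒ α β = map₂ (trans (v-imp ϑ α β)) (true-or-→B (des (val ϑ α)))

  ⊨-¬-intro : ∀ {α} → des (negV (val ϑ α)) ≡ true → ϑ ⊨ (¬' α)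
  ⊨-¬-intro {α} h = trans (cong des (v-neg ϑ α)) h

  ⊨-¬-elim : ∀ {α} → ϑ ⊨ (¬' α) → des (negV (val ϑ α)) ≡ true
  ⊨-¬-elim {α} h = trans (cong des (sym (v-neg ϑ α))) h

  ⊨-∘-intro : ∀ {α} → circD (val ϑ α) ≡ true → ϑ ⊨ (∘' α)
  ⊨-∘-intro {α} h = trans (v-circ ϑ α) h

  ⊨-∘-elim : ∀ {α} → ϑ ⊨ (∘' α) → circD (val ϑ α) ≡ true
  ⊨-∘-elim {α} h = trans (sym (v-circ ϑ α)) h

  val≡⇒⊨-⇔ : ∀ {α β} → val ϑ α ≡ val ϑ β → ϑ ⊨ (α ⇔' β)
  val≡⇒⊨-⇔ e = ⊨-∧-intro (⊨-⇒-intro λ a → trans (cong des (sym e)) a)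
                         (⊨-⇒-intro λ b → trans (cong des e) b)

  classical-∘^suc : ∀ {n k} → InF n k ϑ → ∀ β → Classical (val ϑ (∘^ (suc n) β))
  classical-∘^suc {n} I β =
    classical-circ (val ϑ (∘^ n β)) (val ϑ (∘^ (suc n) β)) (v-circ ϑ (∘^ n β)) (InF.vCc I β)

  val-¬∘^¬ : ∀ {n k} → InF n k ϑ → ∀ j α → 1 ≤ j → j < k →
             val ϑ (¬' (∘^ j (¬' α))) ≡ val ϑ (¬' (∘^ j α))
  val-¬∘^¬ I j α 1≤j j<k = begin
    val ϑ (¬' (∘^ j (¬' α)))   ≡⟨ v-neg ϑ (∘^ j (¬' α)) ⟩
    negV (val ϑ (∘^ j (¬' α))) ≡⟨ cong negV (InF.vip I j α 1≤j j<k) ⟨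
    negV (val ϑ (∘^ j α))      ≡⟨ v-neg ϑ (∘^ j α) ⟨
    val ϑ (¬' (∘^ j α))        ∎
    where open ≡-Reasoning

  val-¬¬ : ∀ α → val ϑ (¬' (¬' α)) ≡ val ϑ α
  val-¬¬ α = begin
    val ϑ (¬' (¬' α))       ≡⟨ v-neg ϑ (¬' α) ⟩
    negV (val ϑ (¬' α))     ≡⟨ cong negV (v-neg ϑ α) ⟩
    negV (negV (val ϑ α))   ≡⟨ negV-involutive (val ϑ α) ⟩
    val ϑ α                 ∎
    where open ≡-Reasoning

  axiom-valid : ∀ {n k α} → InF n k ϑ → Axiom n k α → ϑ ⊨ α
  axiom-valid _ (ax1 α β) = ⊨-⇒-intro λ a → ⊨-⇒-intro λ _ → a
  axiom-valid _ (ax2 α β γ) =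
    ⊨-⇒-intro λ f → ⊨-⇒-intro λ g → ⊨-⇒-intro λ a → ⊨-⇒-elim (⊨-⇒-elim g a) (⊨-⇒-elim f a)
  axiom-valid _ (ax3 α β) = ⊨-⇒-intro λ a → ⊨-⇒-intro λ b → ⊨-∧-intro a b
  axiom-valid _ (ax4 α β) = ⊨-⇒-intro ⊨-∧-elimˡ
  axiom-valid _ (ax5 α β) = ⊨-⇒-intro ⊨-∧-elimʳ
  axiom-valid _ (ax6 α β) = ⊨-⇒-intro ⊨-∨-introˡ
  axiom-valid _ (ax7 α β) = ⊨-⇒-intro ⊨-∨-introʳ
  axiom-valid _ (ax8 α β γ) =
    ⊨-⇒-intro λ f → ⊨-⇒-intro λ g → ⊨-⇒-intro λ d → [ ⊨-⇒-elim f , ⊨-⇒-elim g ]′ (⊨-∨-elim d)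
  axiom-valid _ (ax9 α β) = [ ⊨-∨-introˡ , ⊨-∨-introʳ ]′ (⊨-or-⊨-⇒ α β)
  axiom-valid _ (ax10 α) =
    [ ⊨-∨-introˡ , (λ h → ⊨-∨-introʳ (⊨-¬-intro h)) ]′ (des-or-des-negV (val ϑ α))
  axiom-valid _ (bc1 α β) =
    ⊨-⇒-intro λ c → ⊨-⇒-intro λ a → ⊨-⇒-intro λ n →
      ⊥-elim (circD-explosive (val ϑ α) (⊨-∘-elim c) a (⊨-¬-elim n))
  axiom-valid _ (ciw α) =
    [ (λ c → ⊨-∨-introˡ (⊨-∘-intro c)) , (λ { (a , n) → ⊨-∨-introʳ (⊨-∧-intro a (⊨-¬-intro n)) }) ]′
      (circD-or-contradictory (val ϑ α))
  axiom-valid I (cc α) = ⊨-∘-intro (circD-classical (classical-∘^suc I α))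
  axiom-valid _ (dn α _) = val≡⇒⊨-⇔ (val-¬¬ α)
  axiom-valid I (ip j α 1≤j j<k) = val≡⇒⊨-⇔ (val-¬∘^¬ I j α 1≤j j<k)

  sound : ∀ {n k α} → InF n k ϑ → ⊢[ n , k ] α → ϑ ⊨ α
  sound I (axiom a) = axiom-valid I a
  sound I (mp d e)  = ⊨-⇒-elim (sound I e) (sound I d)

-- The hypothesis 2 ≤ k is unused: soundness holds for every k.
theorem25 : ∀ (n k : ℕ) → 2 ≤ k → ∀ (α : Form) → ⊢[ n , k ] α → ⊨R[ n , k ] α
theorem25 n k _ α d ϑ I = sound ϑ I d
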